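{- Let $A\subseteq\mathbb{N}$ be a $C_p$-set and let $S$ be a finite subset of $\mathbb{P}$. Let $\tau=\mathbb{N}^{\mathbb{N}}$ and let $\mathcal{F}(\tau)$ denote the set of nonempty finite subsets of $\tau$. Then there exist functions $\alpha:\mathcal{F}(\tau)\to\mathbb{N}$ and $H:\mathcal{F}(\tau)\to\{\text{nonempty finite subsets of }\mathbb{N}\}$ such that (1) if $F,G\in\mathcal{F}(\tau)$ and $F\subsetneq G$, then $\max H(F)<\min H(G)$; (2) whenever $(G_n)_{n\in\mathbb{N}}$ is a sequence in $\mathcal{F}(\tau)$ with $G_1\subsetneq G_2\subsetneq\cdots\subsetneq G_n\subsetneq\cdots$ and $f_i\in G_i$ for each $i\in\mathbb{N}$, one has \[\sum_{i\in\beta}\alpha(G_i)+P\Big(\sum_{i\in\beta}\sum_{t\in H(G_i)}f_i(t)\Big)\in A\] for every nonempty finite $\beta\subseteq\mathbb{N}$ and every $P\in S$.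
   Context: $\mathbb{P}$ denotes the set of polynomials with integer coefficients which vanish at $0$ and map $\mathbb{N}$ into $\mathbb{N}$. An IP-set is a family $(x_\alpha)_{\alpha}$ indexed by nonempty finite $\alpha\subseteq\mathbb{N}$, with $x_\alpha=\sum_{t\in\alpha}x_t$ for some sequence $(x_n)$ in $\mathbb{N}$. $A\subseteq\mathbb{N}$ is a $J_p$-set if for every finite $F\subseteq\mathbb{P}$, every $l\in\mathbb{N}$ and all IP-sets $(x^i_\alpha)_\alpha$, $i=1,\dots,l$, there exist $a\in\mathbb{N}\cup\{0\}$ and nonempty finite $\beta\subseteq\mathbb{N}$ with $a+P(x^i_\beta)\in A$ for all $P\in F$, $i\le l$. In $(\beta\mathbb{N},+)$ (ultrafilters on $\mathbb{N}$, $A\in p+q$ iff $\{x:-x+A\in q\}\in p$), $\mathcal{J}_p$ is the set of ultrafilters all of whose members are $J_p$-sets; $A$ is a $C_p$-set if $A\in p$ for some idempotent ($p+p=p$) $p\in\mathcal{J}_p$. -}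

module Defs where

open import Data.Nat using (ℕ; zero; suc; _+_; _≤_; _<_)
open import Data.Integer as ℤ using (ℤ; +_)
open import Data.List using (List; []; _∷_; map)
open import Data.Nat.ListAction using (sum)
open import Data.List.Relation.Unary.All using (All)
open import Data.List.Relation.Unary.Unique.Propositional using (Unique)
open import Data.List.Membership.Propositional using (_∈_; _∉_)
open import Data.Fin using (Fin)
open import Data.Product using (Σ; _×_; ∃; ∃-syntax; _,_)
open import Data.Sum using (_⊎_)
open import Data.Empty using (⊥)
open import Relation.Nullary using (¬_)
open import Relation.Binary.PropositionalEquality using (_≡_; _≢_)

-- Conventions:
--  * the paper's ℕ = {1,2,...}.  NUMBERS (elements of A, values of
--    sequences / of functions in τ, α-values, polynomial arguments) are
--    Agda naturals required to be ≥ 1 where the paper demands it.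
--  * INDICES (of IP-sequences, of the chain (G_n), of β, of the domain
--    of f ∈ τ and of H(F)) are shifted: Agda index k stands for paper
--    index k+1.  This is an order-preserving bijection.

Pred : Set₁
Pred = ℕ → Set

-- polynomial with integer coefficients and zero constant term:
-- [c₁, c₂, …, c_d] represents c₁ x + c₂ x² + … + c_d x^d
Poly : Set
Poly = List ℤ

eval : Poly → ℕ → ℤ
eval P n = go P (+ n)
  where
  go : List ℤ → ℤ → ℤ
  go []       _ = + 0
  go (c ∷ cs) y = c ℤ.* y ℤ.+ go cs (y ℤ.* + n)

InP : Poly → Set
InP P = ∀ n → 1 ≤ n → + 1 ℤ.≤ eval P n

_∋ℤ_ : Pred → ℤ → Set
A ∋ℤ z = ∃[ m ] (z ≡ + m × A m)

-- nonempty finite subset of ℕ (indices), represented as a duplicate-free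
-- nonempty list
NEFin : List ℕ → Set
NEFin β = β ≢ [] × Unique β

-- J_p-set.  IP-sets x^i_β = Σ_{t∈β} x^i_t, i = 1..l (l ≥ 1), generated by
-- sequences of elements of ℕ = {1,2,…}; a ∈ ℕ ∪ {0}.
JpSet : Pred → Set
JpSet A =
  (F : List Poly) → All InP F →
  (l : ℕ) (x : Fin (suc l) → ℕ → ℕ) → (∀ i t → 1 ≤ x i t) →
  ∃[ a ] ∃[ β ] (NEFin β ×
    (∀ P → P ∈ F → ∀ i → A ∋ℤ (+ a ℤ.+ eval P (sum (map (x i) β)))))

-- ultrafilters on ℕ = {1,2,…} (as ultrafilters on Agda ℕ containing
-- the set of positive numbers)
record IsUltrafilter (p : Pred → Set) : Set₁ where
  field
    upward    : ∀ {B C : Pred} → (∀ n → B n → C n) → p B → p C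
    inter     : ∀ {B C : Pred} → p B → p C → p (λ n → B n × C n)
    proper    : ¬ p (λ _ → ⊥)
    ultra     : ∀ (B : Pred) → p B ⊎ p (λ n → ¬ B n)
    positives : p (λ n → 1 ≤ n)

shift : ℕ → Pred → Pred
shift x B y = B (x + y)

_⊕_ : (Pred → Set) → (Pred → Set) → (Pred → Set)
(p ⊕ q) B = p (λ x → q (shift x B))

Idempotent : (Pred → Set) → Set₁
Idempotent p = ∀ (B : Pred) → ((p ⊕ p) B → p B) × (p B → (p ⊕ p) B)

InJp : (Pred → Set) → Set₁
InJp p = ∀ (B : Pred) → p B → JpSet B

CpSet : Pred → Set₁
CpSet A = ∃ λ (p : Pred → Set) →
  IsUltrafilter p × Idempotent p × InJp p × p A

-- τ = ℕ^ℕ : f : ℕ → ℕ with positive values (f k = paper f(k+1))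
Fn : Set
Fn = ℕ → ℕ

PosFn : Fn → Set
PosFn f = ∀ t → 1 ≤ f t

-- F ∈ 𝓕(τ): nonempty finite subset of τ, as a duplicate-free nonempty list
IsFτ : List Fn → Set
IsFτ F = F ≢ [] × Unique F × All PosFn F

_⊊_ : List Fn → List Fn → Set
F ⊊ G = (∀ f → f ∈ F → f ∈ G) × ∃[ g ] (g ∈ G × g ∉ F)

{-# OPTIONS --safe #-}
-- Fix an idempotent ultrafilter p ∈ 𝒥_p with A ∈ p and put A⋆ = {n ∈ A : −n + A ∈ p}; then
-- A⋆ ∈ p and −n + A⋆ ∈ p for every n ∈ A⋆.  The values α(F), H(F) are chosen by recursion on
-- |F|, together with the finitely many pairs (a, s) realised along chains of proper subsets
-- of F, each with a + P(s) ∈ A⋆ for all P ∈ S.  One application of the J_p property to the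
-- member ⋂ (−(a + P(s)) + A⋆) of p, with the polynomials P and z ↦ P(s + z) − P(s) (which lie
-- in ℙ once s is past the point where every P ∈ S increases), extends all these pairs at once
-- by α(F) and by the sums of the f ∈ F over H(F).  The sum along a chain over β is then one of
-- the pairs realised at the largest index of β.
module Submission where

open import Defs
open import Data.Nat using (ℕ; suc; _≤_; _<_)
open import Data.Integer as ℤ using (+_)
open import Data.List using (List; map)
open import Data.Nat.ListAction using (sum)
open import Data.List.Relation.Unary.All using (All)
open import Data.List.Membership.Propositional using (_∈_)
open import Data.Product using (_×_; ∃)

open import Data.Nat using (zero; z≤n; s≤s; _⊔_; _≤′_; ≤′-refl; ≤′-step; NonZero)
import Data.Nat as ℕ
import Data.Nat.Properties as ℕP
import Data.Integer.Properties as ℤP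
open import Data.Integer.Tactic.RingSolver using (solve-∀)
open import Data.Fin using (Fin)
open import Data.List using ([]; _∷_; [_]; _++_; length; lookup; drop; concatMap; applyUpTo; cartesianProductWith)
import Data.List.Properties as ListP
open import Data.List.Extrema.Nat using (max; xs≤max)
open import Data.List.Relation.Unary.All as All using ([]; _∷_)
import Data.List.Relation.Unary.All.Properties as AllP
import Data.List.Relation.Unary.AllPairs as AllPairs
import Data.List.Relation.Unary.AllPairs.Properties as AllPairsP
open import Data.List.Relation.Unary.Any as Any using (here; there)
import Data.List.Relation.Unary.Any.Properties as AnyP
open import Data.List.Relation.Unary.Unique.Propositional using (Unique)
import Data.List.Relation.Unary.Unique.Propositional.Properties as UniqueP
open import Data.List.Relation.Binary.Subset.Propositional using (_⊆_)
open import Data.List.Relation.Binary.Disjoint.Propositional using (Disjoint)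
open import Data.List.Relation.Binary.Permutation.Propositional using (_↭_; ↭⇒↭ₛ)
open import Data.List.Relation.Binary.Permutation.Propositional.Properties
  using (∈-resp-↭; ↭-length; map⁺; All-resp-↭) renaming (shift to ↭-shift)
open import Data.List.Membership.Propositional using (_∉_)
open import Data.List.Membership.Propositional.Properties
  using (∈-∃++; ∈-++⁺ˡ; ∈-++⁺ʳ; ∈-map⁺; ∈-concat⁺′; ∈-cartesianProductWith⁺; ∈-cartesianProductWith⁻; ∈-applyUpTo⁻)
open import Data.List.Membership.DecPropositional ℕP._≟_ using (_∈?_)
open import Data.Nat.ListAction.Properties using (sum-++; sum-↭)
open import Data.Product using (∃-syntax; _,_; proj₁; proj₂)
open import Data.Sum using (_⊎_; inj₁; inj₂)
open import Data.Empty using (⊥; ⊥-elim)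
open import Function using (_∘_; const; id)
open import Relation.Nullary using (yes; no)
open import Relation.Binary.PropositionalEquality
  using (_≡_; _≢_; refl; sym; trans; cong; cong₂; subst; setoid; module ≡-Reasoning)
open import Data.List.Relation.Binary.Permutation.Setoid.Properties (setoid ℕ) using (Unique-resp-↭)

Eventually : (ℕ → Set) → Set
Eventually Q = ∃[ Y ] (∀ m → Y ≤ m → Q m)

Eventually-map : ∀ {Q R : ℕ → Set} → (∀ {m} → Q m → R m) → Eventually Q → Eventually R
Eventually-map f (Y , q) = Y , λ m Y≤m → f (q m Y≤m)

Eventually-× : ∀ {Q R : ℕ → Set} → Eventually Q → Eventually R → Eventually (λ m → Q m × R m)
Eventually-× (Y , q) (Z , r) =
  Y ⊔ Z , λ m le → q m (ℕP.≤-trans (ℕP.m≤m⊔n Y Z) le) , r m (ℕP.≤-trans (ℕP.m≤n⊔m Y Z) le)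

Eventually-∈ : ∀ {X : Set} {Q : X → ℕ → Set} (xs : List X) →
  (∀ x → x ∈ xs → Eventually (Q x)) → Eventually (λ m → ∀ x → x ∈ xs → Q x m)
Eventually-∈ []       _  = 0 , λ _ _ _ ()
Eventually-∈ {Q = Q} (x ∷ xs) ev = Eventually-map combine
  (Eventually-× (ev x (here refl)) (Eventually-∈ xs (λ y y∈xs → ev y (there y∈xs))))
  where
  combine : ∀ {m} → Q x m × (∀ y → y ∈ xs → Q y m) → ∀ y → y ∈ x ∷ xs → Q y m
  combine (q , _) _ (here refl) = q
  combine (_ , r) y (there y∈xs) = r y y∈xs

<1+∧≢⇒< : ∀ {i m} → i < suc m → i ≢ m → i < m
<1+∧≢⇒< i<1+m = ℕP.≤∧≢⇒< (ℕ.s≤s⁻¹ i<1+m)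

module IntegerPolynomials where
  open import Data.Integer using (ℤ; -[1+_]; ∣_∣; _+_; _-_; _*_; -_; +≤+)

  horner : List ℤ → ℤ → ℤ
  horner []       x = + 0
  horner (c ∷ cs) x = c + x * horner cs x

  accumulator≡horner : ∀ m (go : List ℤ → ℤ → ℤ) → (∀ y → go [] y ≡ + 0) →
    (∀ c cs y → go (c ∷ cs) y ≡ c * y + go cs (y * m)) →
    ∀ cs y → go cs y ≡ y * horner cs m
  accumulator≡horner m go go-[] go-∷ []       y = trans (go-[] y) (sym (ℤP.*-zeroʳ y))
  accumulator≡horner m go go-[] go-∷ (c ∷ cs) y = begin
    go (c ∷ cs) y                          ≡⟨ go-∷ c cs y ⟩
    c * y + go cs (y * m)                  ≡⟨ cong (_+_ (c * y)) (accumulator≡horner m go go-[] go-∷ cs (y * m)) ⟩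
    c * y + y * m * horner cs m            ≡⟨ factor c y m (horner cs m) ⟩
    y * (c + m * horner cs m)              ∎
    where
    open ≡-Reasoning
    factor : ∀ c y m h → c * y + y * m * h ≡ y * (c + m * h)
    factor = solve-∀

  -- The accumulator of `eval` is a local function; abstracting its arguments
  -- into fresh variables lets `accumulator≡horner` be instantiated with it.
  eval-∷ : ∀ (P : ℤ × List ℤ) n →
    eval (proj₁ P ∷ proj₂ P) n ≡ proj₁ P * + n + + n * + n * horner (proj₂ P) (+ n)
  eval-∷ P n with proj₁ P List.∷ proj₂ P
  ... | _ with proj₂ P | + n * + n | accumulator≡horner (+ n) _ (λ _ → refl) (λ _ _ _ → refl)
  ... | cs | y | go≡ = cong (_+_ (proj₁ P * + n)) (go≡ cs y)

  eval≡*horner : ∀ P n → eval P n ≡ + n * horner P (+ n)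
  eval≡*horner []       n = sym (ℤP.*-zeroʳ (+ n))
  eval≡*horner (c ∷ cs) n = trans (eval-∷ (c , cs) n) (factor c (+ n) (horner cs (+ n)))
    where
    factor : ∀ c n h → c * n + n * n * h ≡ n * (c + n * h)
    factor = solve-∀

  horner-0∷ : ∀ P n → horner (+ 0 ∷ P) (+ n) ≡ eval P n
  horner-0∷ P n = trans (ℤP.+-identityˡ _) (sym (eval≡*horner P n))

  eval-0 : ∀ P → eval P 0 ≡ + 0
  eval-0 P = trans (eval≡*horner P 0) (ℤP.*-zeroˡ (horner P (+ 0)))

  infixr 5 _+ₚ_
  infixr 6 _·ₚ_

  _+ₚ_ : List ℤ → List ℤ → List ℤ
  []       +ₚ L        = L
  (a ∷ K)  +ₚ []       = a ∷ K
  (a ∷ K)  +ₚ (b ∷ L)  = a + b ∷ K +ₚ L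

  horner-+ₚ : ∀ K L x → horner (K +ₚ L) x ≡ horner K x + horner L x
  horner-+ₚ []      L       x = sym (ℤP.+-identityˡ _)
  horner-+ₚ (a ∷ K) []      x = sym (ℤP.+-identityʳ _)
  horner-+ₚ (a ∷ K) (b ∷ L) x = trans (cong (λ h → a + b + x * h) (horner-+ₚ K L x))
                                      (distrib a b x (horner K x) (horner L x))
    where
    distrib : ∀ a b x u v → a + b + x * (u + v) ≡ a + x * u + (b + x * v)
    distrib = solve-∀

  _·ₚ_ : ℤ → List ℤ → List ℤ
  k ·ₚ L = map (k *_) L

  horner-·ₚ : ∀ k L x → horner (k ·ₚ L) x ≡ k * horner L x
  horner-·ₚ k []      x = sym (ℤP.*-zeroʳ k)
  horner-·ₚ k (a ∷ L) x = trans (cong (λ h → k * a + x * h) (horner-·ₚ k L x))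
                                (distrib k a x (horner L x))
    where
    distrib : ∀ k a x u → k * a + x * (k * u) ≡ k * (a + x * u)
    distrib = solve-∀

  taylorShift : ℤ → List ℤ → List ℤ
  taylorShift a []       = []
  taylorShift a (c ∷ cs) = (c ∷ []) +ₚ (a ·ₚ taylorShift a cs +ₚ (+ 0 ∷ taylorShift a cs))

  horner-taylorShift : ∀ a L x → horner (taylorShift a L) x ≡ horner L (a + x)
  horner-taylorShift a []       x = refl
  horner-taylorShift a (c ∷ cs) x = begin
    horner ((c ∷ []) +ₚ (a ·ₚ T +ₚ (+ 0 ∷ T))) x
      ≡⟨ horner-+ₚ (c ∷ []) (a ·ₚ T +ₚ (+ 0 ∷ T)) x ⟩
    horner (c ∷ []) x + horner (a ·ₚ T +ₚ (+ 0 ∷ T)) x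
      ≡⟨ cong (_+_ (horner (c ∷ []) x)) (horner-+ₚ (a ·ₚ T) (+ 0 ∷ T) x) ⟩
    horner (c ∷ []) x + (horner (a ·ₚ T) x + horner (+ 0 ∷ T) x)
      ≡⟨ cong (λ h → horner (c ∷ []) x + (h + horner (+ 0 ∷ T) x)) (horner-·ₚ a T x) ⟩
    c + x * + 0 + (a * horner T x + (+ 0 + x * horner T x))
      ≡⟨ cong (λ h → c + x * + 0 + (a * h + (+ 0 + x * h))) (horner-taylorShift a cs x) ⟩
    c + x * + 0 + (a * h + (+ 0 + x * h))
      ≡⟨ collect c a x h ⟩
    c + (a + x) * h ∎
    where
    open ≡-Reasoning
    T = taylorShift a cs
    h = horner cs (a + x)
    collect : ∀ c a x h → c + x * + 0 + (a * h + (+ 0 + x * h)) ≡ c + (a + x) * h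
    collect = solve-∀

  horner-drop₁ : ∀ L x → horner L x ≡ horner L (+ 0) + x * horner (drop 1 L) x
  horner-drop₁ []       x = sym (trans (ℤP.+-identityˡ _) (ℤP.*-zeroʳ x))
  horner-drop₁ (c ∷ cs) x = cong (_+ x * horner cs x) (sym (ℤP.+-identityʳ c))

  difference : Poly → ℕ → Poly
  difference P y = drop 1 (taylorShift (+ y) (+ 0 ∷ P))

  eval-difference : ∀ P y n → eval (difference P y) n ≡ eval P (y ℕ.+ n) - eval P y
  eval-difference P y n = begin
    eval (difference P y) n                    ≡⟨ eval≡*horner (difference P y) n ⟩
    + n * horner (difference P y) (+ n)        ≡⟨ solve-for-tail (horner-drop₁ L (+ n)) ⟩
    horner L (+ n) - horner L (+ 0)            ≡⟨ cong₂ _-_ (shifted n)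
                                                            (trans (shifted 0) (cong (eval P) (ℕP.+-identityʳ y))) ⟩
    eval P (y ℕ.+ n) - eval P y                ∎
    where
    open ≡-Reasoning
    L = taylorShift (+ y) (+ 0 ∷ P)
    shifted : ∀ n → horner L (+ n) ≡ eval P (y ℕ.+ n)
    shifted n = trans (horner-taylorShift (+ y) (+ 0 ∷ P) (+ n)) (horner-0∷ P (y ℕ.+ n))
    solve-for-tail : ∀ {a b c} → a ≡ b + c → c ≡ a - b
    solve-for-tail {a} {b} {c} a≡b+c = trans (rearrange b c) (cong (_- b) (sym a≡b+c))
      where
      rearrange : ∀ b c → c ≡ b + c - b
      rearrange = solve-∀

  forwardDifference : Poly → List ℤ
  forwardDifference P = taylorShift (+ 1) (+ 0 ∷ P) +ₚ -[1+ 0 ] ·ₚ (+ 0 ∷ P)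

  horner-forwardDifference : ∀ P m → horner (forwardDifference P) (+ m) ≡ eval P (suc m) - eval P m
  horner-forwardDifference P m = begin
    horner (forwardDifference P) (+ m)
      ≡⟨ horner-+ₚ (taylorShift (+ 1) (+ 0 ∷ P)) (-[1+ 0 ] ·ₚ (+ 0 ∷ P)) (+ m) ⟩
    horner (taylorShift (+ 1) (+ 0 ∷ P)) (+ m) + horner (-[1+ 0 ] ·ₚ (+ 0 ∷ P)) (+ m)
      ≡⟨ cong₂ _+_ (trans (horner-taylorShift (+ 1) (+ 0 ∷ P) (+ m)) (horner-0∷ P (suc m)))
                   (trans (horner-·ₚ -[1+ 0 ] (+ 0 ∷ P) (+ m)) (cong (_*_ -[1+ 0 ]) (horner-0∷ P m))) ⟩
    eval P (suc m) + -[1+ 0 ] * eval P m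
      ≡⟨ minus-one-times (eval P (suc m)) (eval P m) ⟩
    eval P (suc m) - eval P m ∎
    where
    open ≡-Reasoning
    minus-one-times : ∀ a b → a + -[1+ 0 ] * b ≡ a - b
    minus-one-times = solve-∀

  1≤c+m : ∀ c m → suc ∣ c ∣ ≤ m → + 1 ℤ.≤ c + + m
  1≤c+m (+ a)    m 1+a≤m = +≤+ (ℕP.≤-trans (ℕP.≤-trans (s≤s z≤n) 1+a≤m) (ℕP.m≤n+m m a))
  1≤c+m -[1+ a ] m 2+a≤m rewrite ℤP.≤-⊖ (ℕP.≤-trans (ℕP.n≤1+n (suc a)) 2+a≤m) =
    +≤+ (ℕP.≤-trans (ℕP.≤-reflexive (sym (ℕP.m+n∸n≡m 1 a))) (ℕP.∸-monoˡ-≤ (suc a) 2+a≤m))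

  1≤c+m*e : ∀ c m e → + 1 ℤ.≤ e → suc ∣ c ∣ ≤ m → + 1 ℤ.≤ c + + m * e
  1≤c+m*e c m e 1≤e 1+∣c∣≤m = ℤP.≤-trans (1≤c+m c m 1+∣c∣≤m)
    (ℤP.+-monoʳ-≤ c (ℤP.≤-trans (ℤP.≤-reflexive (sym (ℤP.*-identityʳ (+ m))))
                                 (ℤP.*-monoˡ-≤-nonNeg (+ m) 1≤e)))

  EventuallyPositive : (ℕ → ℤ) → Set
  EventuallyPositive f = Eventually (λ m → + 1 ℤ.≤ f m)

  horner-sign : ∀ L → EventuallyPositive (λ m → horner L (+ m))
                    ⊎ EventuallyPositive (λ m → - horner L (+ m))
                    ⊎ (∀ m → horner L (+ m) ≡ + 0)
  horner-sign []       = inj₂ (inj₂ (λ _ → refl))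
  horner-sign (c ∷ cs) with horner-sign cs
  ... | inj₁ cs>0 = inj₁ (Eventually-map (λ (1≤e , le) → 1≤c+m*e c _ _ 1≤e le)
                                         (Eventually-× cs>0 (suc ∣ c ∣ , λ _ le → le)))
  ... | inj₂ (inj₁ cs<0) = inj₂ (inj₁ (Eventually-map (λ (1≤-e , le) → negated 1≤-e le)
                                                       (Eventually-× cs<0 (suc ∣ c ∣ , λ _ le → le))))
    where
    negated : ∀ {m e} → + 1 ℤ.≤ - e → suc ∣ c ∣ ≤ m → + 1 ℤ.≤ - (c + + m * e)
    negated {m} {e} 1≤-e le = subst (+ 1 ℤ.≤_) (sym (negate c (+ m) e))
      (1≤c+m*e (- c) m (- e) 1≤-e (subst (λ k → suc k ≤ m) (sym (ℤP.∣-i∣≡∣i∣ c)) le))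
      where
      negate : ∀ c m e → - (c + m * e) ≡ - c + m * - e
      negate = solve-∀
  ... | inj₂ (inj₂ cs≡0) = constant c (λ m → trans (cong (λ h → c + + m * h) (cs≡0 m))
                                                  (trans (cong (_+_ c) (ℤP.*-zeroʳ (+ m))) (ℤP.+-identityʳ c)))
    where
    constant : ∀ d → (∀ m → horner (c ∷ cs) (+ m) ≡ d) →
      EventuallyPositive (λ m → horner (c ∷ cs) (+ m))
        ⊎ EventuallyPositive (λ m → - horner (c ∷ cs) (+ m))
        ⊎ (∀ m → horner (c ∷ cs) (+ m) ≡ + 0)
    constant (+ zero)  ≡d = inj₂ (inj₂ ≡d)
    constant (+ suc k) ≡d = inj₁ (0 , λ m _ → subst (+ 1 ℤ.≤_) (sym (≡d m)) (+≤+ (s≤s z≤n)))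
    constant -[1+ k ]  ≡d = inj₂ (inj₁ (0 , λ m _ → subst (λ h → + 1 ℤ.≤ - h) (sym (≡d m)) (+≤+ (s≤s z≤n))))

  grows-linearly : ∀ {f : ℕ → ℤ} → Eventually (λ m → + 1 ℤ.≤ f (suc m) - f m) →
                   Eventually (λ y → ∀ k → + k ℤ.≤ f (y ℕ.+ k) - f y)
  grows-linearly {f} (Y , step) = Y , grow
    where
    open ℤP.≤-Reasoning
    grow : ∀ y → Y ≤ y → ∀ k → + k ℤ.≤ f (y ℕ.+ k) - f y
    grow y _    zero    = ℤP.≤-reflexive (sym (trans (cong (λ z → f z - f y) (ℕP.+-identityʳ y))
                                                       (ℤP.+-inverseʳ (f y))))
    grow y Y≤y (suc k) = begin
      + 1 + + k                                         ≤⟨ ℤP.+-mono-≤ (step (y ℕ.+ k) (ℕP.≤-trans Y≤y (ℕP.m≤m+n y k)))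
                                                                        (grow y Y≤y k) ⟩
      (f (suc (y ℕ.+ k)) - f (y ℕ.+ k)) + (f (y ℕ.+ k) - f y)
                                                        ≡⟨ telescope (f (suc (y ℕ.+ k))) (f (y ℕ.+ k)) (f y) ⟩
      f (suc (y ℕ.+ k)) - f y                           ≡⟨ cong (λ z → f z - f y) (ℕP.+-suc y k) ⟨
      f (y ℕ.+ suc k) - f y                             ∎
      where
      telescope : ∀ a b c → (a - b) + (b - c) ≡ a - c
      telescope = solve-∀

  ¬eventually-decreasing : ∀ {f : ℕ → ℤ} → (∀ m → 1 ≤ m → + 1 ℤ.≤ f m) →
                           Eventually (λ m → + 1 ℤ.≤ f m - f (suc m)) → ⊥
  ¬eventually-decreasing {f} f>0 decreasing =
    unbounded (grows-linearly {λ m → - f m}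
      (Eventually-map (λ {m} → subst (+ 1 ℤ.≤_) (swap (f m) (f (suc m)))) decreasing))
    where
    open ℤP.≤-Reasoning
    swap : ∀ a b → a - b ≡ - b - - a
    swap = solve-∀
    cancel : ∀ a b → a + (- a - - b) ≡ b
    cancel = solve-∀
    unbounded : Eventually (λ y → ∀ k → + k ℤ.≤ - f (y ℕ.+ k) - - f y) → ⊥
    unbounded (Y , grow) = ℕP.<-irrefl refl (ℤ.drop‿+≤+ (begin
      + 1 + + k                              ≤⟨ ℤP.+-mono-≤ (f>0 (y ℕ.+ k) (ℕP.≤-trans (s≤s z≤n) (ℕP.m≤m+n y k)))
                                                             (grow y (ℕP.n≤1+n Y) k) ⟩
      f (y ℕ.+ k) + (- f (y ℕ.+ k) - - f y)  ≡⟨ cancel (f (y ℕ.+ k)) (f y) ⟩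
      f y                                    ≡⟨ ℤP.0≤i⇒+∣i∣≡i (ℤP.≤-trans (+≤+ z≤n) (f>0 y (s≤s z≤n))) ⟨
      + k                                    ∎))
      where
      y = suc Y
      k = ∣ f y ∣

  eventually-difference-InP : ∀ P → InP P → Eventually (λ y → InP (difference P y))
  eventually-difference-InP P P∈ℙ with horner-sign (forwardDifference P)
  ... | inj₁ Δ>0 = Eventually-map increasing (grows-linearly {eval P}
                     (Eventually-map (λ {m} → subst (+ 1 ℤ.≤_) (horner-forwardDifference P m)) Δ>0))
    where
    increasing : ∀ {y} → (∀ k → + k ℤ.≤ eval P (y ℕ.+ k) - eval P y) → InP (difference P y)
    increasing {y} grow (suc n) _ =
      ℤP.≤-trans (+≤+ (s≤s z≤n)) (subst (+ suc n ℤ.≤_) (sym (eval-difference P y (suc n))) (grow (suc n)))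
  ... | inj₂ (inj₁ Δ<0) = ⊥-elim (¬eventually-decreasing {eval P} P∈ℙ
                            (Eventually-map (λ {m} → subst (+ 1 ℤ.≤_) (flip m)) Δ<0))
    where
    flip : ∀ m → - horner (forwardDifference P) (+ m) ≡ eval P m - eval P (suc m)
    flip m = trans (cong -_ (horner-forwardDifference P m)) (negate (eval P (suc m)) (eval P m))
      where
      negate : ∀ a b → - (a - b) ≡ b - a
      negate = solve-∀
  ... | inj₂ (inj₂ Δ≡0) = ⊥-elim (1≰0 (subst (+ 1 ℤ.≤_) P[1]≡0 (P∈ℙ 1 (s≤s z≤n))))
    where
    1≰0 : + 1 ℤ.≤ + 0 → ⊥
    1≰0 (+≤+ ())
    P[1]≡0 : eval P 1 ≡ + 0
    P[1]≡0 = begin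
      eval P 1                          ≡⟨ split (eval P 1) (eval P 0) ⟩
      (eval P 1 - eval P 0) + eval P 0  ≡⟨ cong₂ _+_ (trans (sym (horner-forwardDifference P 0)) (Δ≡0 0))
                                                      (eval-0 P) ⟩
      + 0                               ∎
      where
      open ≡-Reasoning
      split : ∀ a b → a ≡ (a - b) + b
      split = solve-∀

open IntegerPolynomials

private variable
  X : Set
  x y : X
  xs ys : List X

∈⇒↭∷ : x ∈ xs → ∃[ ys ] xs ↭ x ∷ ys
∈⇒↭∷ {x = x} x∈xs with ys , zs , refl ← ∈-∃++ x∈xs = ys ++ zs , ↭-shift x ys zs

⊆-∷⁻ : xs ⊆ x ∷ ys → x ∉ xs → xs ⊆ ys
⊆-∷⁻ xs⊆x∷ys x∉xs v∈xs with xs⊆x∷ys v∈xs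
... | here refl   = ⊥-elim (x∉xs v∈xs)
... | there v∈ys  = v∈ys

⊆-remove : xs ⊆ ys → y ∈ ys → y ∉ xs → ∃[ zs ] (xs ⊆ zs × length ys ≡ suc (length zs))
⊆-remove xs⊆ys y∈ys y∉xs with zs , σ ← ∈⇒↭∷ y∈ys =
  zs , ⊆-∷⁻ (∈-resp-↭ σ ∘ xs⊆ys) y∉xs , ↭-length σ

length-mono : Unique xs → xs ⊆ ys → length xs ≤ length ys
length-mono {xs = []}     _ _ = z≤n
length-mono {xs = x ∷ xs} u x∷xs⊆ys
  with zs , xs⊆zs , len ←
         ⊆-remove (x∷xs⊆ys ∘ there) (x∷xs⊆ys (here refl)) (UniqueP.Unique[x∷xs]⇒x∉xs u) =
  ℕP.≤-trans (s≤s (length-mono (AllPairs.tail u) xs⊆zs)) (ℕP.≤-reflexive (sym len))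

length-mono-< : Unique xs → xs ⊆ ys → y ∈ ys → y ∉ xs → length xs < length ys
length-mono-< u xs⊆ys y∈ys y∉xs with zs , xs⊆zs , len ← ⊆-remove xs⊆ys y∈ys y∉xs =
  ℕP.≤-trans (s≤s (length-mono u xs⊆zs)) (ℕP.≤-reflexive (sym len))

listsOfLength≤ : ℕ → List X → List (List X)
listsOfLength≤ zero    xs = [ [] ]
listsOfLength≤ (suc k) xs = [] ∷ cartesianProductWith _∷_ xs (listsOfLength≤ k xs)

∈-listsOfLength≤⁻ : ∀ k → ys ∈ listsOfLength≤ k xs → length ys ≤ k
∈-listsOfLength≤⁻ zero    (here refl) = z≤n
∈-listsOfLength≤⁻ (suc k) (here refl) = z≤n
∈-listsOfLength≤⁻ {xs = xs} (suc k) (there ys∈)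
  with _ , zs , _ , zs∈ , refl ← ∈-cartesianProductWith⁻ _∷_ xs (listsOfLength≤ k xs) ys∈ =
  s≤s (∈-listsOfLength≤⁻ k zs∈)

∈-listsOfLength≤⁺ : ∀ k → length ys ≤ k → ys ⊆ xs → ys ∈ listsOfLength≤ k xs
∈-listsOfLength≤⁺ {ys = []}     zero    _         _     = here refl
∈-listsOfLength≤⁺ {ys = []}     (suc k) _         _     = here refl
∈-listsOfLength≤⁺ {ys = y ∷ ys} (suc k) (s≤s len) y∷ys⊆xs =
  there (∈-cartesianProductWith⁺ _∷_ (y∷ys⊆xs (here refl)) (∈-listsOfLength≤⁺ k len (y∷ys⊆xs ∘ there)))

shorterLists : List X → List (List X)
shorterLists []       = []
shorterLists (x ∷ xs) = listsOfLength≤ (length xs) (x ∷ xs)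

∈-shorterLists⁻ : ∀ xs → ys ∈ shorterLists xs → length ys < length xs
∈-shorterLists⁻ (x ∷ xs) ys∈ = s≤s (∈-listsOfLength≤⁻ (length xs) ys∈)

∈-shorterLists⁺ : length ys < length xs → ys ⊆ xs → ys ∈ shorterLists xs
∈-shorterLists⁺ {xs = x ∷ xs} (s≤s len) ys⊆xs = ∈-listsOfLength≤⁺ (length xs) len ys⊆xs

module Blocks where
  open import Data.Nat using (_+_; _*_)
  open import Data.Nat.DivMod using (_/_; m<n⇒m/n≡0; m*n/n≡m; +-distrib-/-∣ʳ)
  open import Data.Nat.Divisibility using (n∣m*n)

  sum-map-concatMap : ∀ (g : ℕ → ℕ) (h : X → List ℕ) xs →
    sum (map g (concatMap h xs)) ≡ sum (map (λ x → sum (map g (h x))) xs)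
  sum-map-concatMap g h []       = refl
  sum-map-concatMap g h (x ∷ xs) = begin
    sum (map g (h x ++ concatMap h xs))               ≡⟨ cong sum (ListP.map-++ g (h x) (concatMap h xs)) ⟩
    sum (map g (h x) ++ map g (concatMap h xs))       ≡⟨ sum-++ (map g (h x)) (map g (concatMap h xs)) ⟩
    sum (map g (h x)) + sum (map g (concatMap h xs))  ≡⟨ cong (_+_ (sum (map g (h x)))) (sum-map-concatMap g h xs) ⟩
    sum (map g (h x)) + sum (map (λ x → sum (map g (h x))) xs) ∎
    where open ≡-Reasoning

  block : ℕ → ℕ → ℕ → List ℕ
  block L o t = applyUpTo (λ j → o + (j + t * L)) L

  module _ {L : ℕ} .{{_ : NonZero L}} where

    [j+t*L]/L≡t : ∀ {j} t → j < L → (j + t * L) / L ≡ t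
    [j+t*L]/L≡t {j} t j<L = trans (+-distrib-/-∣ʳ j (n∣m*n t)) (cong₂ _+_ (m<n⇒m/n≡0 j<L) (m*n/n≡m t L))

    block-unique : ∀ o t → Unique (block L o t)
    block-unique o t = UniqueP.applyUpTo⁺₁ _ L λ i<j _ →
      ℕP.<⇒≢ (ℕP.+-monoʳ-< o (ℕP.+-monoˡ-< (t * L) i<j))

    blocks-disjoint : ∀ {o t t'} → t ≢ t' → Disjoint (block L o t) (block L o t')
    blocks-disjoint {o} {t} {t'} t≢t' (v∈ , v∈')
      with j , j<L , refl ← ∈-applyUpTo⁻ (λ j → o + (j + t * L)) v∈
         | j' , j'<L , v≡ ← ∈-applyUpTo⁻ (λ j → o + (j + t' * L)) v∈' =
      t≢t' (begin
        t                  ≡⟨ [j+t*L]/L≡t t j<L ⟨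
        (j + t * L) / L    ≡⟨ cong (_/ L) (ℕP.+-cancelˡ-≡ o _ _ v≡) ⟩
        (j' + t' * L) / L  ≡⟨ [j+t*L]/L≡t t' j'<L ⟩
        t'                 ∎)
      where open ≡-Reasoning

    blocks-unique : ∀ o {ts} → Unique ts → Unique (concatMap (block L o) ts)
    blocks-unique o {ts} ts-unique = UniqueP.concat⁺
      (AllP.map⁺ (All.universal (block-unique o) ts))
      (AllPairsP.map⁺ (AllPairs.map (blocks-disjoint {o}) ts-unique))

  blocks-bounded : ∀ L o ts → All (o ≤_) (concatMap (block L o) ts)
  blocks-bounded L o ts =
    AllP.concat⁺ (AllP.map⁺ (All.universal (λ t → AllP.applyUpTo⁺₂ _ L (λ j → ℕP.m≤m+n o _)) ts))

open Blocks

module UltrafilterProperties {p : Pred → Set} (U : IsUltrafilter p) where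
  open import Data.Nat using (_+_)
  open IsUltrafilter U

  ⋂∈p : ∀ {Z : Set} {Q : Z → Pred} {zs} → All (p ∘ Q) zs → p (λ n → All (λ z → Q z n) zs)
  ⋂∈p []             = upward (λ _ _ → []) positives
  ⋂∈p (pQ ∷ pQs) = upward (λ _ (q , qs) → q ∷ qs) (inter pQ (⋂∈p pQs))

  module Idempotence (idempotent : Idempotent p) where

    _⋆ : Pred → Pred
    (X ⋆) n = X n × p (shift n X)

    ⋆∈p : ∀ {X} → p X → p (X ⋆)
    ⋆∈p X∈p = inter X∈p (proj₂ (idempotent _) X∈p)

    shift-⋆∈p : ∀ {X m} → (X ⋆) m → p (shift m (X ⋆))
    shift-⋆∈p {X} {m} (_ , shift-X∈p) = inter shift-X∈p
      (upward (λ n → upward (λ k → subst X (sym (ℕP.+-assoc m n k)))) (proj₂ (idempotent (shift m X)) shift-X∈p))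

    ∋ℤ-shift∈p : ∀ {X z} → (X ⋆) ∋ℤ z → p (λ n → (X ⋆) ∋ℤ (z ℤ.+ + n))
    ∋ℤ-shift∈p {X} (m , refl , m∈X⋆) = upward (λ n m+n∈X⋆ → m + n , refl , m+n∈X⋆) (shift-⋆∈p {X} {m} m∈X⋆)

identity : Poly
identity = + 1 ∷ []

identity-InP : InP identity
identity-InP n 1≤n = subst (+ 1 ℤ.≤_) (sym (trans (ℤP.+-identityʳ _) (ℤP.*-identityˡ (+ n)))) (ℤ.+≤+ 1≤n)

-- The ultrafilter axioms only show that a member is not empty; its J_p property supplies an element.
JpSet-element : ∀ {X} → JpSet X → ∃ X
JpSet-element X-Jp
  with _ , _ , _ , hit ← X-Jp (identity ∷ []) (identity-InP ∷ []) 0 (λ _ _ → 1) (λ _ _ → ℕP.≤-refl)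
  with m , _ , m∈X ← hit identity (here refl) Fin.zero = m , m∈X

⊊⇒∈shorterLists : ∀ {F G} → Unique F → F ⊊ G → F ∈ shorterLists G
⊊⇒∈shorterLists F-unique (F⊆G , g , g∈G , g∉F) =
  ∈-shorterLists⁺ (length-mono-< F-unique (F⊆G _) g∈G g∉F) (F⊆G _)

module Construction
  (A : Pred) (p : Pred → Set) (U : IsUltrafilter p) (idempotent : Idempotent p)
  (p⊆Jp : InJp p) (A∈p : p A) (S : List Poly) (S⊆ℙ : All InP S) where
  open import Data.Nat using (_+_)

  open IsUltrafilter U
  open UltrafilterProperties U
  open Idempotence idempotent

  threshold : Eventually (λ y → ∀ P → P ∈ S → InP (difference P y))
  threshold = Eventually-∈ S (λ P P∈S → eventually-difference-InP P (All.lookup S⊆ℙ P∈S))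

  Y₀ : ℕ
  Y₀ = proj₁ threshold

  value : ℕ × ℕ → Poly → ℤ.ℤ
  value (a , s) P = + a ℤ.+ eval P s

  Admissible : ℕ × ℕ → Set
  Admissible e = Y₀ ≤ proj₂ e × All (λ P → (A ⋆) ∋ℤ value e P) S

  targets : List (ℕ × ℕ) → List ℤ.ℤ
  targets W = cartesianProductWith value W S

  differences : List (ℕ × ℕ) → List Poly
  differences W = cartesianProductWith (λ e P → difference P (proj₂ e)) W S

  targets-∈A⋆ : ∀ {W} → All Admissible W → All ((A ⋆) ∋ℤ_) (targets W)
  targets-∈A⋆ {W} W-adm = AllP.cartesianProductWith⁺ (setoid _) (setoid _) value W S
    (λ e∈W P∈S → All.lookup (proj₂ (All.lookup W-adm e∈W)) P∈S)

  S++differences-ℙ : ∀ {W} → All Admissible W → All InP (S ++ differences W)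
  S++differences-ℙ {W} W-adm = AllP.++⁺ S⊆ℙ (AllP.cartesianProductWith⁺ (setoid _) (setoid _) _ W S
    (λ e∈W P∈S → proj₂ threshold _ (proj₁ (All.lookup W-adm e∈W)) _ P∈S))

  Translates : List ℤ.ℤ → Pred
  Translates zs n = All (λ z → (A ⋆) ∋ℤ (z ℤ.+ + n)) zs

  Translates∈p : ∀ {zs} → All ((A ⋆) ∋ℤ_) zs → p (Translates zs)
  Translates∈p = ⋂∈p ∘ All.map ∋ℤ-shift∈p

  ∋ℤ-Translates : ∀ {zs w} → Translates zs ∋ℤ w → All (λ z → (A ⋆) ∋ℤ (z ℤ.+ w)) zs
  ∋ℤ-Translates (_ , refl , translates) = translates

  -- The recursion runs over all lists of functions, not only over 𝓕(τ); clamping at 1 keeps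
  -- the IP-sets positive and changes nothing on 𝓕(τ) (sumOver-PosFn).
  atLeast1 : Fn → Fn
  atLeast1 f t = 1 ⊔ f t

  sumOver : List ℕ → Fn → ℕ
  sumOver H f = sum (map (atLeast1 f) H)

  L : ℕ
  L = suc Y₀

  length≤sumOver : ∀ H f → length H ≤ sumOver H f
  length≤sumOver []      f = z≤n
  length≤sumOver (h ∷ H) f = ℕP.+-mono-≤ (ℕP.m≤m⊔n 1 (f h)) (length≤sumOver H f)

  -- Index t stands for a block of L consecutive indices, so every sum over H(F) exceeds Y₀
  -- and the differences of S at it lie in ℙ.
  -- J_p-sets are tested on at least one IP-set: the constant sequence pads the case F = [].
  ipSequence : ∀ F → ℕ → Fin (suc (length F)) → ℕ → ℕ
  ipSequence F o i t = sumOver (block L o t) (lookup (const 1 ∷ F) i)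

  ipSequence-positive : ∀ F o i t → 1 ≤ ipSequence F o i t
  ipSequence-positive F o i t =
    ℕP.≤-trans (s≤s z≤n) (length≤sumOver (block L o t) (lookup (const 1 ∷ F) i))

  sum-ipSequence : ∀ {F f} o β (f∈ : f ∈ const 1 ∷ F) →
    sum (map (ipSequence F o (Any.index f∈)) β) ≡ sumOver (concatMap (block L o) β) f
  sum-ipSequence {F} {f} o β f∈ =
    trans (cong (λ g → sum (map (λ t → sumOver (block L o t) g) β)) (sym (AnyP.lookup-index f∈)))
          (sym (sum-map-concatMap (atLeast1 f) (block L o) β))

  Y₀<sumOver-blocks : ∀ o {β} → β ≢ [] → ∀ f → Y₀ < sumOver (concatMap (block L o) β) f
  Y₀<sumOver-blocks o {[]}    β≢[] f = ⊥-elim (β≢[] refl)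
  Y₀<sumOver-blocks o {t ∷ β} _    f =
    ℕP.≤-trans L≤length (length≤sumOver (concatMap (block L o) (t ∷ β)) f)
    where
    L≤length : L ≤ length (concatMap (block L o) (t ∷ β))
    L≤length = ℕP.≤-trans (ℕP.≤-reflexive (sym (ListP.length-applyUpTo (λ j → o + (j + t ℕ.* L)) L)))
                          (ListP.length-++-≤ˡ (block L o t))

  blocks≢[] : ∀ o {β} → β ≢ [] → concatMap (block L o) β ≢ []
  blocks≢[] o {[]}    β≢[] = ⊥-elim (β≢[] refl)
  blocks≢[] o {_ ∷ _} _    = λ ()

  fresh : ℕ → List ℕ → Fn → ℕ × ℕ
  fresh α H f = α , sumOver H f

  extended : ℕ → List ℕ → ℕ × ℕ → Fn → ℕ × ℕ
  extended α H (a , s) f = a + α , s + sumOver H f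

  record Extension (F : List Fn) (W : List (ℕ × ℕ)) (o : ℕ) : Set where
    field
      α                   : ℕ
      H                   : List ℕ
      1≤α                 : 1 ≤ α
      H-NEFin             : NEFin H
      o≤H                 : All (o ≤_) H
      fresh-admissible    : ∀ {f} → f ∈ F → Admissible (fresh α H f)
      extended-admissible : ∀ {e f} → e ∈ W → f ∈ F → Admissible (extended α H e f)

  JpHits : ℕ → List Fn → List (ℕ × ℕ) → ℕ → ℕ → List ℕ → Set
  JpHits c F W o a β = ∀ Q → Q ∈ S ++ differences W → ∀ i →
    Translates (+ c ∷ map (ℤ._+ + c) (targets W)) ∋ℤ (+ a ℤ.+ eval Q (sum (map (ipSequence F o i) β)))

  extension : ∀ F {W} → All Admissible W → ∀ o {c} a β → 1 ≤ c → NEFin β → JpHits c F W o a β →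
              Extension F W o
  extension F {W} W-adm o {c} a β 1≤c (β≢[] , β-unique) hits = record
    { α = c + a ; H = H ; 1≤α = ℕP.≤-trans 1≤c (ℕP.m≤m+n c a)
    ; H-NEFin = blocks≢[] o β≢[] , blocks-unique o β-unique ; o≤H = blocks-bounded L o β
    ; fresh-admissible = λ {f} f∈F → ℕP.<⇒≤ (Y₀<sumOver-blocks o β≢[] f) , All.tabulate (fresh-∈A⋆ f∈F)
    ; extended-admissible = λ e∈W f∈F →
        ℕP.≤-trans (proj₁ (All.lookup W-adm e∈W)) (ℕP.m≤m+n _ _) , All.tabulate (extended-∈A⋆ e∈W f∈F)
    }
    where
    H = concatMap (block L o) β
    hit : ∀ {f Q} → f ∈ F → Q ∈ S ++ differences W →
          All (λ z → (A ⋆) ∋ℤ (z ℤ.+ (+ a ℤ.+ eval Q (sumOver H f)))) (+ c ∷ map (ℤ._+ + c) (targets W))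
    hit {f} {Q} f∈F Q∈ = subst (λ s → All (λ z → (A ⋆) ∋ℤ (z ℤ.+ (+ a ℤ.+ eval Q s))) _)
      (sum-ipSequence o β (there f∈F)) (∋ℤ-Translates (hits Q Q∈ (Any.index (there {x = const 1} f∈F))))
    fresh-∈A⋆ : ∀ {f P} → f ∈ F → P ∈ S → (A ⋆) ∋ℤ value (fresh (c + a) H f) P
    fresh-∈A⋆ {f} {P} f∈F P∈S with c∈A⋆ ∷ _ ← hit f∈F (∈-++⁺ˡ P∈S) =
      subst ((A ⋆) ∋ℤ_) (sym (ℤP.+-assoc (+ c) (+ a) (eval P (sumOver H f)))) c∈A⋆
    extended-∈A⋆ : ∀ {e f P} → e ∈ W → f ∈ F → P ∈ S → (A ⋆) ∋ℤ value (extended (c + a) H e f) P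
    extended-∈A⋆ {e@(e₁ , e₂)} {f} {P} e∈W f∈F P∈S
      with _ ∷ shifted ← hit f∈F (∈-++⁺ʳ S (∈-cartesianProductWith⁺ _ e∈W P∈S)) =
      subst ((A ⋆) ∋ℤ_) eq (All.lookup (AllP.map⁻ shifted) (∈-cartesianProductWith⁺ value e∈W P∈S))
      where
      s = sumOver H f
      eq : value e P ℤ.+ + c ℤ.+ (+ a ℤ.+ eval (difference P e₂) s) ≡ value (extended (c + a) H e f) P
      eq = trans (cong (λ d → value e P ℤ.+ + c ℤ.+ (+ a ℤ.+ d)) (eval-difference P e₂ s))
                 (regroup (+ e₁) (eval P e₂) (+ c) (+ a) (eval P (e₂ + s)))
        where
        regroup : ∀ e₁ y c a z → e₁ ℤ.+ y ℤ.+ c ℤ.+ (a ℤ.+ (z ℤ.- y)) ≡ e₁ ℤ.+ (c ℤ.+ a) ℤ.+ z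
        regroup = solve-∀

  -- c ∈ A⋆ keeps α = c + a ≥ 1 even when J_p returns a = 0.
  opaque
    extend : ∀ F {W} → All Admissible W → ∀ o → Extension F W o
    extend F {W} W-adm o
      with c , 1≤c , c∈A⋆ , c∈T ← JpSet-element (p⊆Jp _
             (inter positives (inter (⋆∈p A∈p) (Translates∈p (targets-∈A⋆ W-adm)))))
      with a , β , β-NEFin , hits ← p⊆Jp _ (Translates∈p ((c , refl , c∈A⋆) ∷ AllP.map⁺ c∈T))
             (S ++ differences W) (S++differences-ℙ W-adm) (length F) (ipSequence F o) (ipSequence-positive F o)
      = extension F W-adm o a β 1≤c β-NEFin hits

  record Node : Set where
    field
      α                : ℕ
      H                : List ℕ
      pairs            : List (ℕ × ℕ)
      1≤α              : 1 ≤ α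
      H-NEFin          : NEFin H
      offset           : ℕ
      offset≤H         : All (offset ≤_) H
      pairs-admissible : All Admissible pairs

  node-over : List Fn → List Node → Node
  node-over F below = record
    { α = α ; H = H ; pairs = map (fresh α H) F ++ cartesianProductWith (extended α H) W F
    ; 1≤α = 1≤α ; H-NEFin = H-NEFin ; offset = o ; offset≤H = o≤H
    ; pairs-admissible = AllP.++⁺ (AllP.map⁺ (All.tabulate fresh-admissible))
                                  (AllP.cartesianProductWith⁺ (setoid _) (setoid _) _ W F extended-admissible)
    }
    where
    W = concatMap Node.pairs below
    o = suc (max 0 (concatMap Node.H below))
    open Extension (extend F (AllP.concat⁺ (AllP.map⁺ (All.universal Node.pairs-admissible below))) o)

  build : ℕ → List Fn → Node
  build zero    F = node-over F []
  build (suc k) F = node-over F (map (build k) (shorterLists F))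

  build-stable : ∀ {k k'} F → length F < k → length F < k' → build k F ≡ build k' F
  build-stable {suc k} {suc k'} F (s≤s |F|≤k) (s≤s |F|≤k') =
    cong (node-over F) (ListP.map-cong-local (All.tabulate λ {G} G∈ →
      let |G|<|F| = ∈-shorterLists⁻ F G∈ in
      build-stable G (ℕP.<-≤-trans |G|<|F| |F|≤k) (ℕP.<-≤-trans |G|<|F| |F|≤k')))

  node : List Fn → Node
  node F = build (suc (length F)) F

  build≡node : ∀ {F G} → G ∈ shorterLists F → build (length F) G ≡ node G
  build≡node {F} {G} G∈ = build-stable G (∈-shorterLists⁻ F G∈) ℕP.≤-refl

  α : List Fn → ℕ
  α F = Node.α (node F)

  H : List Fn → List ℕ
  H F = Node.H (node F)

  H-below : ∀ {F G x z} → G ∈ shorterLists F → x ∈ H G → z ∈ H F → x < z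
  H-below {F} {G} {x} G∈ x∈HG z∈HF =
    ℕP.<-≤-trans (s≤s x≤max) (All.lookup (Node.offset≤H (node F)) z∈HF)
    where
    x≤max : x ≤ max 0 (concatMap Node.H (map (build (length F)) (shorterLists F)))
    x≤max = All.lookup (xs≤max 0 _)
      (∈-concat⁺′ (subst (λ n → x ∈ Node.H n) (sym (build≡node {F} G∈)) x∈HG)
                  (∈-map⁺ Node.H (∈-map⁺ (build (length F)) G∈)))

  fresh-realised : ∀ {F f} → f ∈ F → fresh (α F) (H F) f ∈ Node.pairs (node F)
  fresh-realised f∈F = ∈-++⁺ˡ (∈-map⁺ _ f∈F)

  extended-realised : ∀ {F G e f} → G ∈ shorterLists F → e ∈ Node.pairs (node G) → f ∈ F →
                      extended (α F) (H F) e f ∈ Node.pairs (node F)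
  extended-realised {F} {G} {e} {f} G∈ e∈ f∈F = ∈-++⁺ʳ (map (fresh (α F) (H F)) F)
    (∈-cartesianProductWith⁺ (extended (α F) (H F))
      (∈-concat⁺′ (subst (λ n → e ∈ Node.pairs n) (sym (build≡node {F} G∈)) e∈)
                  (∈-map⁺ Node.pairs (∈-map⁺ (build (length F)) G∈)))
      f∈F)

  sumOver-PosFn : ∀ {f} H → PosFn f → sumOver H f ≡ sum (map f H)
  sumOver-PosFn H f-pos = cong sum (ListP.map-cong (λ t → ℕP.m≤n⇒m⊔n≡n (f-pos t)) H)

  module Chain (G : ℕ → List Fn) (G-Fτ : ∀ n → IsFτ (G n)) (G⊊ : ∀ n → G n ⊊ G (suc n))
               (f : ℕ → Fn) (f∈G : ∀ i → f i ∈ G i) where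

    G-mono : ∀ {k m} → k ≤′ m → G k ⊆ G m
    G-mono ≤′-refl          = id
    G-mono (≤′-step k≤′m) = proj₁ (G⊊ _) _ ∘ G-mono k≤′m

    G-shorter : ∀ {k m} → k < m → G k ∈ shorterLists (G m)
    G-shorter {k} k<m with G⊊ k
    ... | _ , g , g∈ , g∉ =
      ∈-shorterLists⁺ (length-mono-< (proj₁ (proj₂ (G-Fτ k))) Gk⊆Gm (G-mono (ℕP.≤⇒≤′ k<m) g∈) g∉) Gk⊆Gm
      where
      Gk⊆Gm = G-mono (ℕP.≤⇒≤′ (ℕP.<⇒≤ k<m))

    a s : ℕ → ℕ
    a i = α (G i)
    s i = sumOver (H (G i)) (f i)

    pair : List ℕ → ℕ × ℕ
    pair β = sum (map a β) , sum (map s β)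

    pair-↭ : ∀ {β β'} → β ↭ β' → pair β ≡ pair β'
    pair-↭ σ = cong₂ _,_ (sum-↭ (map⁺ a σ)) (sum-↭ (map⁺ s σ))

    pair-realised : ∀ m β → Unique β → All (_< m) β → β ≢ [] →
                    ∃[ k ] (k < m × pair β ∈ Node.pairs (node (G k)))
    pair-realised zero    []      _ _        β≢[] = ⊥-elim (β≢[] refl)
    pair-realised zero    (_ ∷ _) _ (() ∷ _) _
    pair-realised (suc m) β β-unique β<1+m β≢[] with m ∈? β
    ... | no m∉β
      with k , k<m , realised ← pair-realised m β β-unique
             (All.tabulate (λ i∈β → <1+∧≢⇒< (All.lookup β<1+m i∈β) (λ { refl → m∉β i∈β }))) β≢[]
      = k , ℕP.m<n⇒m<1+n k<m , realised
    ... | yes m∈β with β' , σ ← ∈⇒↭∷ m∈β =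
      m , ℕP.n<1+n m , subst (_∈ Node.pairs (node (G m))) (sym (pair-↭ σ)) (top β' β'-unique β'<m)
      where
      m∷β'-unique : Unique (m ∷ β')
      m∷β'-unique = Unique-resp-↭ (↭⇒↭ₛ σ) β-unique
      β'-unique : Unique β'
      β'-unique = AllPairs.tail m∷β'-unique
      β'<m : All (_< m) β'
      β'<m = All.zipWith (λ (i<1+m , m≢i) → <1+∧≢⇒< i<1+m (m≢i ∘ sym))
                         (All.tail (All-resp-↭ σ β<1+m) , AllPairs.head m∷β'-unique)
      top : ∀ γ → Unique γ → All (_< m) γ → pair (m ∷ γ) ∈ Node.pairs (node (G m))
      top []          _ _ = subst (_∈ Node.pairs (node (G m)))
        (sym (cong₂ _,_ (ℕP.+-identityʳ (a m)) (ℕP.+-identityʳ (s m)))) (fresh-realised (f∈G m))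
      top γ@(_ ∷ _) γ-unique γ<m with k , k<m , realised ← pair-realised m γ γ-unique γ<m (λ ())
        = subst (_∈ Node.pairs (node (G m))) (cong₂ _,_ (ℕP.+-comm _ (a m)) (ℕP.+-comm _ (s m)))
            (extended-realised (G-shorter k<m) realised (f∈G m))

    sums-in-A : ∀ β → NEFin β → ∀ P → P ∈ S →
      A ∋ℤ (+ sum (map a β) ℤ.+ eval P (sum (map (λ i → sum (map (f i) (H (G i)))) β)))
    sums-in-A β (β≢[] , β-unique) P P∈S
      with k , _ , realised ← pair-realised (suc (max 0 β)) β β-unique (All.map s≤s (xs≤max 0 β)) β≢[]
      with n , eq , n∈A , _ ← All.lookup (proj₂ (All.lookup (Node.pairs-admissible (node (G k))) realised)) P∈S
      = n , trans (cong (λ z → + sum (map a β) ℤ.+ eval P z) (sym sum-s)) eq , n∈A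
      where
      sum-s : sum (map s β) ≡ sum (map (λ i → sum (map (f i) (H (G i)))) β)
      sum-s = cong sum (ListP.map-cong
        (λ i → sumOver-PosFn (H (G i)) (All.lookup (proj₂ (proj₂ (G-Fτ i))) (f∈G i))) β)

corollary2p11 : (A : Pred) → CpSet A → (S : List Poly) → All InP S →
    ∃ λ (α : List Fn → ℕ) → ∃ λ (H : List Fn → List ℕ) →
      (∀ F → IsFτ F → 1 ≤ α F × NEFin (H F))
      × (∀ F G → IsFτ F → IsFτ G → F ⊊ G →
           ∀ s t → s ∈ H F → t ∈ H G → s < t)
      × (∀ (G : ℕ → List Fn) → (∀ n → IsFτ (G n)) → (∀ n → G n ⊊ G (suc n)) →
         ∀ (f : ℕ → Fn) → (∀ i → f i ∈ G i) →
         ∀ β → NEFin β → ∀ P → P ∈ S →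
           A ∋ℤ (+ sum (map (λ i → α (G i)) β)
                 ℤ.+ eval P (sum (map (λ i → sum (map (f i) (H (G i)))) β))))
corollary2p11 A (p , U , idempotent , p⊆Jp , A∈p) S S⊆ℙ =
  α , H ,
  (λ F _ → Node.1≤α (node F) , Node.H-NEFin (node F)) ,
  (λ F G F-Fτ _ F⊊G _ _ s∈HF t∈HG → H-below (⊊⇒∈shorterLists (proj₁ (proj₂ F-Fτ)) F⊊G) s∈HF t∈HG) ,
  Chain.sums-in-A
  where open Construction A p U idempotent p⊆Jp A∈p S S⊆ℙ
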